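{- Let $G$ be a finite simple graph without isolated vertices, with degree pairs $(d_i,m_i)_{i=1}^n$. Then for any edge $ij\in E(G)$ with $d_j\leq m_i$, $$d_i\leq m_i(m_j-1)+1,$$ with equality if and only if $d_j=m_i$ and all neighbors of $j$ other than $i$ have degree $1$.
   Context: For a vertex $i$, $d_i$ is its degree and $m_i=d_i^{ -1}\sum_{j:\, ji\in E(G)} d_j$ is its average $2$-degree (the mean of the degrees of its neighbors). -}

module Defs where

open import Data.Nat using (ℕ; zero; suc)
open import Data.Bool using (Bool; true; false; if_then_else_)
open import Data.Fin using (Fin)
open import Data.List using (List; map; filter; length; allFin)
open import Data.Nat.ListAction using (sum)
open import Data.Integer using (+_)
open import Data.Rational using (ℚ; _/_; 0ℚ)
open import Relation.Binary.PropositionalEquality using (_≡_)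
open import Data.Empty using (⊥)

record SimpleGraph (n : ℕ) : Set where
  field
    adj      : Fin n → Fin n → Bool
    symm     : ∀ i j → adj i j ≡ adj j i
    irrefl   : ∀ i → adj i i ≡ false

open SimpleGraph public

Edge : ∀ {n} → SimpleGraph n → Fin n → Fin n → Set
Edge G i j = adj G i j ≡ true

neighbours : ∀ {n} → SimpleGraph n → Fin n → List (Fin n)
neighbours G i = filter (λ j → Data.Bool.T? (adj G i j)) (allFin _)
  where import Data.Bool

deg : ∀ {n} → SimpleGraph n → Fin n → ℕ
deg G i = length (neighbours G i)

twoSum : ∀ {n} → SimpleGraph n → Fin n → ℕ
twoSum G i = sum (map (deg G) (neighbours G i))

-- average 2-degree m_i = d_i⁻¹ Σ_{j ~ i} d_j (only meaningful when d_i ≠ 0;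
-- for an isolated vertex we return 0, a value never used below since the
-- graph is assumed to have no isolated vertices)
avg2deg : ∀ {n} → SimpleGraph n → Fin n → ℚ
avg2deg G i with deg G i
... | zero  = 0ℚ
... | suc k = (+ twoSum G i) / suc k

NoIsolated : ∀ {n} → SimpleGraph n → Set
NoIsolated G = ∀ i → deg G i ≡ 0 → ⊥

module Submission where

-- Lemma 4.6.  Let ij be an edge of a graph without isolated vertices and write
-- a = d_i = 1 + a', b = d_j = 1 + b', S_i = a m_i and S_j = b m_j for the
-- neighbour-degree sums.  Two facts about the neighbourhoods drive the proof:
--   * the hypothesis d_j ≤ m_i says S_i = b a + e for some e ≥ 0, and d_j = m_i
--     iff e = 0;
--   * S_j = d_i + Σ_{k ~ j, k ≠ i} d_k = a + b' + f, where f = Σ (d_k − 1) over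
--     the other neighbours k of j, so f = 0 iff they are all leaves.
-- Clearing the denominator ab, the numerator of m_i (m_j − 1) + 1 equals
-- a·ab + surplus with surplus = f·ab + e·(a' + f) ≥ 0.  This gives the
-- inequality, and equality holds iff the surplus vanishes, i.e. iff f = 0 and
-- e·a' = 0; finally a' = 0 (i is a leaf) forces S_i = d_j, i.e. e = 0.
-- The file develops: natural-number arithmetic of the surplus; sums over
-- duplicate-free lists with one member singled out; the neighbourhood
-- decomposition in a simple graph; rational arithmetic of the fractions
-- involved; the bound in terms of the parameters; and the theorem.

open import Defs
open import Data.Nat as ℕ using (ℕ; zero; suc)
import Data.Nat.Properties as ℕP
open import Data.Product using (_×_; _,_; proj₁; proj₂)
open import Data.Empty using (⊥-elim)
open import Function.Bundles using (_⇔_; mk⇔; Equivalence)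
open import Relation.Binary.PropositionalEquality
open import Algebra.Properties.CommutativeSemigroup ℕP.+-commutativeSemigroup
  using () renaming (x∙yz≈y∙xz to +-left-comm)

module SurplusArithmetic where
  open import Data.Nat using (_+_; _*_)
  open import Data.Nat.Tactic.RingSolver using (solve-∀)
  open import Data.Sum using (inj₁; inj₂)

  m≡m+n⇔n≡0 : ∀ m n → (m ≡ m + n) ⇔ (n ≡ 0)
  m≡m+n⇔n≡0 m n = mk⇔ (λ eq → ℕP.+-cancelˡ-≡ m n 0 (trans (sym eq) (sym (ℕP.+-identityʳ m))))
                      (λ { refl → sym (ℕP.+-identityʳ m) })

  -- With a = 1 + a', b = 1 + b': the amount by which the cleared numerator of
  -- m_i (m_j − 1) + 1 exceeds a·ab, when S_i = ba + e and S_j = b + a' + f.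
  surplus : (a' b' e f : ℕ) → ℕ
  surplus a' b' e f = f * (suc a' * suc b') + e * (a' + f)

  -- (ba + e)(a' + f) + ab = a·ab + surplus  (the ring solver needs surplus unfolded)
  cleared-numerator : ∀ a' b' e f →
    (suc b' * suc a' + e) * (a' + f) + suc a' * suc b' ≡ suc a' * (suc a' * suc b') + surplus a' b' e f
  cleared-numerator = polynomial-identity
    where
    polynomial-identity : ∀ a' b' e f →
      (suc b' * suc a' + e) * (a' + f) + suc a' * suc b'
        ≡ suc a' * (suc a' * suc b') + (f * (suc a' * suc b') + e * (a' + f))
    polynomial-identity = solve-∀

  surplus≡0⇔ : ∀ a' b' e f → (a' ≡ 0 → e ≡ 0) → (surplus a' b' e f ≡ 0) ⇔ (e ≡ 0 × f ≡ 0)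
  surplus≡0⇔ a' b' e f leaf = mk⇔ to (λ { (refl , refl) → refl })
    where
    to : surplus a' b' e f ≡ 0 → e ≡ 0 × f ≡ 0
    to s≡0 = e≡0 , ℕP.m*n≡0⇒m≡0 f (suc a' * suc b') (ℕP.m+n≡0⇒m≡0 _ s≡0)
      where
      e≡0 : e ≡ 0
      e≡0 with ℕP.m*n≡0⇒m≡0∨n≡0 e (ℕP.m+n≡0⇒n≡0 (f * (suc a' * suc b')) s≡0)
      ... | inj₁ e≡0    = e≡0
      ... | inj₂ a'+f≡0 = leaf (ℕP.m+n≡0⇒m≡0 a' a'+f≡0)

module ListSums where
  open import Data.Nat using (_+_; _∸_; _≤_)
  open import Data.Nat.ListAction using (sum)
  open import Data.List using (List; []; _∷_; map; length; filter)
  open import Data.List.Properties using (filter-all; filter-accept; filter-reject)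
  open import Data.List.Membership.Propositional using (_∈_)
  open import Data.List.Relation.Unary.Any using (here; there)
  open import Data.List.Relation.Unary.All as All using (All; []; _∷_)
  open import Data.List.Relation.Unary.Unique.Propositional using (Unique; _∷_)
  open import Data.List.Relation.Binary.Permutation.Propositional
    using (_↭_; ↭-refl; ↭-prep; ↭-swap; ↭-reflexive; module PermutationReasoning)
  open import Relation.Binary.Definitions using (DecidableEquality)
  open import Relation.Nullary using (¬?)

  module _ {A : Set} (_≟_ : DecidableEquality A) where

    without : A → List A → List A
    without x = filter (λ k → ¬? (k ≟ x))

    ↭-extract : ∀ {x xs} → Unique xs → x ∈ xs → xs ↭ x ∷ without x xs
    ↭-extract {x} {y ∷ ys} (y∉ys ∷ _) (here refl) = ↭-prep y (↭-reflexive (sym rest-kept))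
      where
      -- y is dropped from the front, and no later entry equals y
      rest-kept : without y (y ∷ ys) ≡ ys
      rest-kept = trans (filter-reject (λ k → ¬? (k ≟ y)) (λ y≢y → y≢y refl))
                        (filter-all (λ k → ¬? (k ≟ y)) (All.map (λ y≢k k≡y → y≢k (sym k≡y)) y∉ys))
    ↭-extract {x} {y ∷ ys} (y∉ys ∷ uniq) (there x∈ys) = begin
      y ∷ ys                  ↭⟨ ↭-prep y (↭-extract uniq x∈ys) ⟩
      y ∷ x ∷ without x ys    ↭⟨ ↭-swap y x ↭-refl ⟩
      x ∷ y ∷ without x ys    ≡⟨ cong (x ∷_) (filter-accept (λ k → ¬? (k ≟ x)) (All.lookup y∉ys x∈ys)) ⟨
      x ∷ without x (y ∷ ys)  ∎
      -- y ≢ x because x occurs in ys, which avoids y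
      where open PermutationReasoning

  module _ {A : Set} (d : A → ℕ) where

    excess : List A → ℕ
    excess xs = sum (map (λ k → d k ∸ 1) xs)

    sum≡length+excess : ∀ xs → All (λ k → 1 ≤ d k) xs → sum (map d xs) ≡ length xs + excess xs
    sum≡length+excess []       []           = refl
    sum≡length+excess (x ∷ xs) (1≤dx ∷ pos) = begin
      d x + sum (map d xs)                      ≡⟨ cong₂ _+_ (sym (ℕP.m+[n∸m]≡n 1≤dx)) (sum≡length+excess xs pos) ⟩
      suc ((d x ∸ 1) + (length xs + excess xs)) ≡⟨ cong suc (+-left-comm (d x ∸ 1) (length xs) (excess xs)) ⟩
      suc (length xs + excess (x ∷ xs))         ∎
      where open ≡-Reasoning

    excess≡0⇔ : ∀ xs → All (λ k → 1 ≤ d k) xs → (excess xs ≡ 0) ⇔ All (λ k → d k ≡ 1) xs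
    excess≡0⇔ []       []           = mk⇔ (λ _ → []) (λ _ → refl)
    excess≡0⇔ (x ∷ xs) (1≤dx ∷ pos) = mk⇔ to from
      where
      open Equivalence (excess≡0⇔ xs pos) renaming (to to rest-to; from to rest-from)
      to : excess (x ∷ xs) ≡ 0 → All (λ k → d k ≡ 1) (x ∷ xs)
      to e≡0 = ℕP.≤-antisym (ℕP.m∸n≡0⇒m≤n (ℕP.m+n≡0⇒m≡0 (d x ∸ 1) e≡0)) 1≤dx
             ∷ rest-to (ℕP.m+n≡0⇒n≡0 (d x ∸ 1) e≡0)
      from : All (λ k → d k ≡ 1) (x ∷ xs) → excess (x ∷ xs) ≡ 0
      from (dx≡1 ∷ ones) = cong₂ _+_ (cong (_∸ 1) dx≡1) (rest-from ones)

module Neighbourhoods {n} (G : SimpleGraph n) where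
  open import Data.Nat using (_+_; _∸_; _≤_)
  open import Data.Nat.ListAction using (sum)
  open import Data.Nat.ListAction.Properties using (sum-↭)
  open import Data.Fin as Fin using (Fin)
  open import Data.Bool using (T?)
  open import Data.Bool.Properties using (T-≡)
  open import Data.List using (List; []; _∷_; map; length; allFin)
  open import Data.List.Membership.Propositional using (_∈_)
  open import Data.List.Membership.Propositional.Properties using (∈-filter⁺; ∈-filter⁻; ∈-allFin)
  open import Data.List.Relation.Unary.All as All using (All)
  open import Data.List.Relation.Unary.Unique.Propositional using (Unique)
  import Data.List.Relation.Unary.Unique.Propositional.Properties as UniqueP
  open import Data.List.Relation.Binary.Permutation.Propositional using (_↭_)
  open import Data.List.Relation.Binary.Permutation.Propositional.Properties using (↭-length; map⁺)
  open import Relation.Nullary using (¬?)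
  open ListSums

  neighbours-unique : ∀ i → Unique (neighbours G i)
  neighbours-unique i = UniqueP.filter⁺ (λ k → T? (adj G i k)) (UniqueP.allFin⁺ n)

  ∈-neighbours⇔ : ∀ {i k} → k ∈ neighbours G i ⇔ Edge G i k
  ∈-neighbours⇔ {i} {k} = mk⇔
    (λ k∈ → Equivalence.to T-≡ (proj₂ (∈-filter⁻ (λ l → T? (adj G i l)) {xs = allFin n} k∈)))
    (λ ik → ∈-filter⁺ (λ l → T? (adj G i l)) (∈-allFin k) (Equivalence.from T-≡ ik))

  otherNeighbours : Fin n → Fin n → List (Fin n)
  otherNeighbours j i = without Fin._≟_ i (neighbours G j)

  ∈-otherNeighbours⇔ : ∀ {i j k} → k ∈ otherNeighbours j i ⇔ (Edge G j k × k ≢ i)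
  ∈-otherNeighbours⇔ {i} {j} = mk⇔
    (λ k∈ → let k∈N , k≢i = ∈-filter⁻ (λ l → ¬? (l Fin.≟ i)) {xs = neighbours G j} k∈
            in Equivalence.to ∈-neighbours⇔ k∈N , k≢i)
    (λ (jk , k≢i) → ∈-filter⁺ (λ l → ¬? (l Fin.≟ i)) (Equivalence.from ∈-neighbours⇔ jk) k≢i)

  neighbours-around : ∀ {i j} → Edge G j i → neighbours G j ↭ i ∷ otherNeighbours j i
  neighbours-around ji = ↭-extract Fin._≟_ (neighbours-unique _) (Equivalence.from ∈-neighbours⇔ ji)

  deg-around : ∀ {i j} → Edge G j i → deg G j ≡ suc (length (otherNeighbours j i))
  deg-around ji = ↭-length (neighbours-around ji)

  twoSum-around : ∀ {i j} → Edge G j i → twoSum G j ≡ deg G i + sum (map (deg G) (otherNeighbours j i))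
  twoSum-around ji = sum-↭ (map⁺ (deg G) (neighbours-around ji))

  otherExcess : Fin n → Fin n → ℕ
  otherExcess j i = excess (deg G) (otherNeighbours j i)

  module _ (noIsolated : NoIsolated G) where

    positive-degrees : ∀ ks → All (λ k → 1 ≤ deg G k) ks
    positive-degrees ks = All.tabulate (λ {k} _ → ℕP.n≢0⇒n>0 (noIsolated k))

    twoSum-decomposition : ∀ {i j} → Edge G j i → twoSum G j ≡ deg G i + (deg G j ∸ 1 + otherExcess j i)
    twoSum-decomposition {i} {j} ji = begin
      twoSum G j                                     ≡⟨ twoSum-around ji ⟩
      deg G i + sum (map (deg G) others)             ≡⟨ cong (deg G i +_) (sum≡length+excess (deg G) others
                                                                            (positive-degrees others)) ⟩
      deg G i + (length others + otherExcess j i)    ≡⟨ cong (λ l → deg G i + (l + otherExcess j i))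
                                                             (cong (_∸ 1) (deg-around ji)) ⟨
      deg G i + (deg G j ∸ 1 + otherExcess j i)      ∎
      where
      open ≡-Reasoning
      others : List (Fin n)
      others = otherNeighbours j i

    otherExcess≡0⇔ : ∀ {i j} → (otherExcess j i ≡ 0) ⇔ (∀ k → Edge G j k → k ≢ i → deg G k ≡ 1)
    otherExcess≡0⇔ {i} {j} = mk⇔
      (λ f≡0 k jk k≢i → All.lookup (to f≡0) (Equivalence.from ∈-otherNeighbours⇔ (jk , k≢i)))
      (λ leaves → from (All.tabulate (λ k∈ → let jk , k≢i = Equivalence.to ∈-otherNeighbours⇔ k∈
                                              in leaves _ jk k≢i)))
      where open Equivalence (excess≡0⇔ (deg G) (otherNeighbours j i) (positive-degrees _))

  leaf-twoSum : ∀ {i j} → Edge G i j → deg G i ≡ 1 → twoSum G i ≡ deg G j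
  leaf-twoSum {i} {j} ij dᵢ≡1 = begin
    twoSum G i                                             ≡⟨ twoSum-around ij ⟩
    deg G j + sum (map (deg G) (otherNeighbours i j))      ≡⟨ cong (deg G j +_) (empty-sum (otherNeighbours i j) no-others) ⟩
    deg G j + 0                                            ≡⟨ ℕP.+-identityʳ (deg G j) ⟩
    deg G j                                                ∎
    where
    open ≡-Reasoning
    no-others : length (otherNeighbours i j) ≡ 0
    no-others = ℕP.suc-injective (trans (sym (deg-around ij)) dᵢ≡1)
    empty-sum : ∀ ks → length ks ≡ 0 → sum (map (deg G) ks) ≡ 0
    empty-sum [] _ = refl

open SurplusArithmetic
open Neighbourhoods

-- The rational operators share their names with those
-- of ℕ, so they are imported only from here on; computations go through the
-- unnormalised rationals, where a fraction is literally a pair.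
open import Data.Integer as ℤ using (ℤ; +_)
import Data.Integer.Properties as ℤP
open import Data.Integer.Tactic.RingSolver using (solve-∀)
open import Data.Rational using (ℚ; _/_; _≤_; _+_; _*_; _-_; -_; 1ℚ; toℚᵘ)
import Data.Rational.Properties as ℚP
open import Data.Rational.Unnormalised as ℚᵘ using (mkℚᵘ; *≡*; *≤*)
import Data.Rational.Unnormalised.Properties as ℚᵘP
open import Data.Product.Function.NonDependent.Propositional using (_×-⇔_)
open import Function.Properties.Equivalence using () renaming (trans to ⇔-trans; sym to ⇔-sym)

toℚᵘ-/ : ∀ z n → toℚᵘ (z / suc n) ℚᵘ.≃ mkℚᵘ z n
toℚᵘ-/ z n = ℚP.toℚᵘ-fromℚᵘ (mkℚᵘ z n)

module _ (p q c : ℕ) where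
  private
    p*c : + (p ℕ.* suc c) ≡ + p ℤ.* + suc c
    p*c = ℤP.pos-* p (suc c)
    q*1 : + q ≡ + q ℤ.* + 1
    q*1 = sym (ℤP.*-identityʳ (+ q))

  ≤-/⇔ : ((+ p) / 1 ≤ (+ q) / suc c) ⇔ (p ℕ.* suc c ℕ.≤ q)
  ≤-/⇔ = mk⇔
    (λ le → cleared (ℚᵘP.≤-respʳ-≃ (toℚᵘ-/ (+ q) c) (ℚᵘP.≤-respˡ-≃ (toℚᵘ-/ (+ p) 0) (ℚP.toℚᵘ-mono-≤ le))))
    (λ le → ℚP.toℚᵘ-cancel-≤ (ℚᵘP.≤-respʳ-≃ (ℚᵘP.≃-sym (toℚᵘ-/ (+ q) c))
              (ℚᵘP.≤-respˡ-≃ (ℚᵘP.≃-sym (toℚᵘ-/ (+ p) 0)) (uncleared le))))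
    where
    cleared : mkℚᵘ (+ p) 0 ℚᵘ.≤ mkℚᵘ (+ q) c → p ℕ.* suc c ℕ.≤ q
    cleared (*≤* le) = ℤP.drop‿+≤+ (subst₂ ℤ._≤_ (sym p*c) (sym q*1) le)
    uncleared : p ℕ.* suc c ℕ.≤ q → mkℚᵘ (+ p) 0 ℚᵘ.≤ mkℚᵘ (+ q) c
    uncleared le = *≤* (subst₂ ℤ._≤_ p*c q*1 (ℤ.+≤+ le))

  ≡-/⇔ : ((+ p) / 1 ≡ (+ q) / suc c) ⇔ (p ℕ.* suc c ≡ q)
  ≡-/⇔ = mk⇔
    (λ eq → cleared (ℚᵘP.≃-trans (ℚᵘP.≃-sym (toℚᵘ-/ (+ p) 0)) (ℚᵘP.≃-trans (ℚP.toℚᵘ-cong eq) (toℚᵘ-/ (+ q) c))))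
    (λ eq → ℚP.toℚᵘ-injective (ℚᵘP.≃-trans (toℚᵘ-/ (+ p) 0)
              (ℚᵘP.≃-trans (uncleared eq) (ℚᵘP.≃-sym (toℚᵘ-/ (+ q) c)))))
    where
    cleared : mkℚᵘ (+ p) 0 ℚᵘ.≃ mkℚᵘ (+ q) c → p ℕ.* suc c ≡ q
    cleared (*≡* eq) = ℤP.+-injective (trans p*c (trans eq (sym q*1)))
    uncleared : p ℕ.* suc c ≡ q → mkℚᵘ (+ p) 0 ℚᵘ.≃ mkℚᵘ (+ q) c
    uncleared eq = *≡* (trans (sym p*c) (trans (cong +_ eq) q*1))

toℚᵘ-shape : ∀ x y → toℚᵘ (x * (y - 1ℚ) + 1ℚ) ℚᵘ.≃ toℚᵘ x ℚᵘ.* (toℚᵘ y ℚᵘ.- ℚᵘ.1ℚᵘ) ℚᵘ.+ ℚᵘ.1ℚᵘ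
toℚᵘ-shape x y = begin
  toℚᵘ (x * (y - 1ℚ) + 1ℚ)                      ≈⟨ ℚP.toℚᵘ-homo-+ (x * (y - 1ℚ)) 1ℚ ⟩
  toℚᵘ (x * (y - 1ℚ)) ℚᵘ.+ ℚᵘ.1ℚᵘ                ≈⟨ ℚᵘP.+-congˡ ℚᵘ.1ℚᵘ (ℚP.toℚᵘ-homo-* x (y - 1ℚ)) ⟩
  toℚᵘ x ℚᵘ.* toℚᵘ (y - 1ℚ) ℚᵘ.+ ℚᵘ.1ℚᵘ          ≈⟨ ℚᵘP.+-congˡ ℚᵘ.1ℚᵘ (ℚᵘP.*-congˡ {toℚᵘ x} y-1) ⟩
  toℚᵘ x ℚᵘ.* (toℚᵘ y ℚᵘ.- ℚᵘ.1ℚᵘ) ℚᵘ.+ ℚᵘ.1ℚᵘ   ∎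
  where
  open ℚᵘP.≃-Reasoning
  y-1 : toℚᵘ (y - 1ℚ) ℚᵘ.≃ toℚᵘ y ℚᵘ.- ℚᵘ.1ℚᵘ
  y-1 = ℚᵘP.≃-trans (ℚP.toℚᵘ-homo-+ y (- 1ℚ)) (ℚᵘP.+-congʳ (toℚᵘ y) (ℚP.toℚᵘ-homo‿- 1ℚ))

evaluateᵘ : ∀ S T a' b' →
  mkℚᵘ (+ S) a' ℚᵘ.* (mkℚᵘ (+ (suc b' ℕ.+ T)) b' ℚᵘ.- ℚᵘ.1ℚᵘ) ℚᵘ.+ ℚᵘ.1ℚᵘ
    ℚᵘ.≃ mkℚᵘ (+ (S ℕ.* T ℕ.+ suc a' ℕ.* suc b')) (b' ℕ.+ a' ℕ.* suc b')
evaluateᵘ S T a' b' = *≡* (begin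
    (+ S ℤ.* (+ (b ℕ.+ T) ℤ.* + 1 ℤ.+ ℤ.- (+ 1) ℤ.* β) ℤ.* + 1 ℤ.+ + 1 ℤ.* + (a ℕ.* (b ℕ.* 1))) ℤ.* + (a ℕ.* b)
      ≡⟨ cong₂ (λ x y → (+ S ℤ.* (x ℤ.* + 1 ℤ.+ ℤ.- (+ 1) ℤ.* β) ℤ.* + 1 ℤ.+ + 1 ℤ.* y) ℤ.* + (a ℕ.* b))
               (ℤP.pos-+ b T) ab-cast ⟩
    numerator ℤ.* + (a ℕ.* b)
      ≡⟨ cong (numerator ℤ.*_) (ℤP.pos-* a b) ⟩
    numerator ℤ.* αβ
      ≡⟨ cross-multiplied (+ S) (+ T) α β ⟩
    (+ S ℤ.* + T ℤ.+ αβ) ℤ.* αβ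
      ≡⟨ cong₂ (λ x y → (x ℤ.+ y) ℤ.* αβ) (ℤP.pos-* S T) (ℤP.pos-* a b) ⟨
    (+ (S ℕ.* T) ℤ.+ + (a ℕ.* b)) ℤ.* αβ
      ≡⟨ cong₂ ℤ._*_ (ℤP.pos-+ (S ℕ.* T) (a ℕ.* b)) (trans (cong +_ (ℕP.*-identityʳ _)) ab-cast) ⟨
    + (S ℕ.* T ℕ.+ a ℕ.* b) ℤ.* + (a ℕ.* (b ℕ.* 1) ℕ.* 1) ∎)
  where
  open ≡-Reasoning
  a b : ℕ
  a = suc a'
  b = suc b'
  α β αβ : ℤ
  α = + a
  β = + b
  αβ = α ℤ.* β
  numerator : ℤ
  numerator = + S ℤ.* ((β ℤ.+ + T) ℤ.* + 1 ℤ.+ ℤ.- (+ 1) ℤ.* β) ℤ.* + 1 ℤ.+ + 1 ℤ.* αβ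
  ab-cast : + (a ℕ.* (b ℕ.* 1)) ≡ αβ
  ab-cast = trans (cong (λ x → + (a ℕ.* x)) (ℕP.*-identityʳ b)) (ℤP.pos-* a b)
  cross-multiplied : ∀ s t α β →
    (s ℤ.* ((β ℤ.+ t) ℤ.* + 1 ℤ.+ ℤ.- (+ 1) ℤ.* β) ℤ.* + 1 ℤ.+ + 1 ℤ.* (α ℤ.* β)) ℤ.* (α ℤ.* β)
      ≡ (s ℤ.* t ℤ.+ α ℤ.* β) ℤ.* (α ℤ.* β)
  cross-multiplied = solve-∀

evaluate : ∀ S T a' b' →
  (+ S) / suc a' * ((+ (suc b' ℕ.+ T)) / suc b' - 1ℚ) + 1ℚ
    ≡ (+ (S ℕ.* T ℕ.+ suc a' ℕ.* suc b')) / (suc a' ℕ.* suc b')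
evaluate S T a' b' = ℚP.toℚᵘ-injective (begin
  toℚᵘ (x * (y - 1ℚ) + 1ℚ)                                           ≈⟨ toℚᵘ-shape x y ⟩
  toℚᵘ x ℚᵘ.* (toℚᵘ y ℚᵘ.- ℚᵘ.1ℚᵘ) ℚᵘ.+ ℚᵘ.1ℚᵘ                       ≈⟨ ℚᵘP.+-congˡ ℚᵘ.1ℚᵘ
                                                                         (ℚᵘP.*-cong (toℚᵘ-/ (+ S) a')
                                                                           (ℚᵘP.+-congˡ (ℚᵘ.- ℚᵘ.1ℚᵘ) (toℚᵘ-/ (+ (suc b' ℕ.+ T)) b'))) ⟩
  mkℚᵘ (+ S) a' ℚᵘ.* (mkℚᵘ (+ (suc b' ℕ.+ T)) b' ℚᵘ.- ℚᵘ.1ℚᵘ) ℚᵘ.+ ℚᵘ.1ℚᵘ ≈⟨ evaluateᵘ S T a' b' ⟩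
  mkℚᵘ (+ N) (b' ℕ.+ a' ℕ.* suc b')                                  ≈⟨ ℚᵘP.≃-sym (toℚᵘ-/ (+ N) (b' ℕ.+ a' ℕ.* suc b')) ⟩
  toℚᵘ ((+ N) / (suc a' ℕ.* suc b'))                                 ∎)
  where
  open ℚᵘP.≃-Reasoning
  x y : ℚ
  x = (+ S) / suc a'
  y = (+ (suc b' ℕ.+ T)) / suc b'
  N : ℕ
  N = S ℕ.* T ℕ.+ suc a' ℕ.* suc b'

parametric-bound : ∀ a' b' e f →
  ((+ suc a') / 1 ≤ (+ (suc b' ℕ.* suc a' ℕ.+ e)) / suc a' * ((+ (suc b' ℕ.+ (a' ℕ.+ f))) / suc b' - 1ℚ) + 1ℚ)
  × (((+ suc a') / 1 ≡ (+ (suc b' ℕ.* suc a' ℕ.+ e)) / suc a' * ((+ (suc b' ℕ.+ (a' ℕ.+ f))) / suc b' - 1ℚ) + 1ℚ)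
     ⇔ (surplus a' b' e f ≡ 0))
parametric-bound a' b' e f rewrite evaluate (suc b' ℕ.* suc a' ℕ.+ e) (a' ℕ.+ f) a' b' =
    Equivalence.from (≤-/⇔ (suc a') N c) (subst (a·ab ℕ.≤_) (sym numerator≡) (ℕP.m≤m+n a·ab s))
  , ⇔-trans (≡-/⇔ (suc a') N c) (subst (λ M → (a·ab ≡ M) ⇔ (s ≡ 0)) (sym numerator≡) (m≡m+n⇔n≡0 a·ab s))
  where
  -- the cleared numerator N over the denominator ab = 1 + c
  N c a·ab s : ℕ
  N = (suc b' ℕ.* suc a' ℕ.+ e) ℕ.* (a' ℕ.+ f) ℕ.+ suc a' ℕ.* suc b'
  c = b' ℕ.+ a' ℕ.* suc b'
  a·ab = suc a' ℕ.* (suc a' ℕ.* suc b')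
  s = surplus a' b' e f
  numerator≡ : N ≡ a·ab ℕ.+ s
  numerator≡ = cleared-numerator a' b' e f

degree-pair-bound : ∀ a' b' Sᵢ Sⱼ f {P : Set} →
  Sⱼ ≡ suc b' ℕ.+ (a' ℕ.+ f) → (f ≡ 0 ⇔ P) → (a' ≡ 0 → Sᵢ ≡ suc b') →
  (+ suc b') / 1 ≤ (+ Sᵢ) / suc a' →
  ((+ suc a') / 1 ≤ (+ Sᵢ) / suc a' * ((+ Sⱼ) / suc b' - 1ℚ) + 1ℚ)
  × (((+ suc a') / 1 ≡ (+ Sᵢ) / suc a' * ((+ Sⱼ) / suc b' - 1ℚ) + 1ℚ)
     ⇔ (((+ suc b') / 1 ≡ (+ Sᵢ) / suc a') × P))
degree-pair-bound a' b' Sᵢ Sⱼ f refl f≡0⇔P leaf dⱼ≤mᵢ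
  with e , refl ← ℕP.m≤n⇒∃[o]m+o≡n (Equivalence.to (≤-/⇔ (suc b') Sᵢ a') dⱼ≤mᵢ) =
    proj₁ (parametric-bound a' b' e f)
  , ⇔-trans (proj₂ (parametric-bound a' b' e f)) (⇔-trans (surplus≡0⇔ a' b' e f e≡0-at-leaf) (⇔-sym dⱼ≡mᵢ⇔e≡0 ×-⇔ f≡0⇔P))
  where
  ba : ℕ
  ba = suc b' ℕ.* suc a'
  dⱼ≡mᵢ⇔e≡0 : ((+ suc b') / 1 ≡ (+ (ba ℕ.+ e)) / suc a') ⇔ (e ≡ 0)
  dⱼ≡mᵢ⇔e≡0 = ⇔-trans (≡-/⇔ (suc b') (ba ℕ.+ e) a') (m≡m+n⇔n≡0 ba e)
  -- a leaf i has S_i = d_j, so no excess over d_i d_j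
  e≡0-at-leaf : a' ≡ 0 → e ≡ 0
  e≡0-at-leaf a'≡0 = Equivalence.to (m≡m+n⇔n≡0 (suc b') e) (begin
    suc b'                       ≡⟨ leaf a'≡0 ⟨
    suc b' ℕ.* suc a' ℕ.+ e      ≡⟨ cong (λ x → suc b' ℕ.* suc x ℕ.+ e) a'≡0 ⟩
    suc b' ℕ.* 1 ℕ.+ e           ≡⟨ cong (ℕ._+ e) (ℕP.*-identityʳ (suc b')) ⟩
    suc b' ℕ.+ e                 ∎)
    where open ≡-Reasoning

lemma4p6 : ∀ {n} (G : SimpleGraph n) → NoIsolated G →
    ∀ i j → Edge G i j →
    (+ deg G j) / 1 ≤ avg2deg G i →
    ((+ deg G i) / 1 ≤ avg2deg G i * (avg2deg G j - 1ℚ) + 1ℚ)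
    × (((+ deg G i) / 1 ≡ avg2deg G i * (avg2deg G j - 1ℚ) + 1ℚ)
    ⇔ (((+ deg G j) / 1 ≡ avg2deg G i)
    × (∀ k → Edge G j k → k ≢ i → deg G k ≡ 1)))
-- avg2deg is defined by cases on the degree, so we case on both degrees; they
-- are positive, and degree-pair-bound applies to the neighbourhood facts:
-- S_j = d_j + (d_i − 1) + f, f = 0 iff the other neighbours of j are leaves,
-- and S_i = d_j when i is a leaf.
lemma4p6 G noIsolated i j ij dⱼ≤mᵢ with deg G i in dᵢ | deg G j in dⱼ
... | zero   | _      = ⊥-elim (noIsolated i dᵢ)
... | suc _  | zero   = ⊥-elim (noIsolated j dⱼ)
... | suc a' | suc b' =
  degree-pair-bound a' b' (twoSum G i) (twoSum G j) (otherExcess G j i)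
    (trans (subst₂ (λ x y → twoSum G j ≡ x ℕ.+ (y ℕ.∸ 1 ℕ.+ otherExcess G j i)) dᵢ dⱼ
                   (twoSum-decomposition G noIsolated (trans (symm G j i) ij)))
           (cong suc (+-left-comm a' b' (otherExcess G j i))))
    (otherExcess≡0⇔ G noIsolated)
    (λ a'≡0 → trans (leaf-twoSum G ij (trans dᵢ (cong suc a'≡0))) dⱼ)
    dⱼ≤mᵢ
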